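{- For every positive integer $n$ let $x(n)=z(n)-(r(n)+1)m(n)$, where $z(n)$, $m(n)$, $r(n)$ are as defined in the context. Then: (i) $x(n)=0$ if and only if $n\in\{436,451,529,545,546\}$. (ii) $x(n)<0$ if and only if either $n\le 435$, or $n=450$, or $513\le n\le 528$. (iii) $x(n)>0$ if and only if either $437\le n\le 512$ with $n\ne 450,451$, or $n\ge 530$ with $n\ne 545,546$. (iv) $x(n)>0$ for every $n\ge 547$. (v) The sequence $x(n)$ ($n=1,2,\dots$) has no maximal value, i.e. it is unbounded above. (vi) $x(129)=-59$ and $x(n)\ge -58$ for every positive integer $n\ne 129$.
   Context: For a positive integer $n$: $z(n)$ denotes the largest integer such that $3z(n)<2n$; $m(n)$ denotes the largest integer such that $m(n)^2\le 2n$; $r(n)$ denotes the least non-negative integer such that $n\le 2^{r(n)}$; and $x(n)=z(n)-(r(n)+1)m(n)$. -}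

module Defs where

open import Data.Nat using (ℕ; zero; suc; _+_; _*_; _^_; _≤_; _<_; _≤?_; _<?_)
open import Data.Integer using (ℤ; +_; _-_) renaming (_*_ to _*ℤ_)
open import Relation.Nullary using (Dec; yes; no)

-- largestUpTo P b : the largest k ≤ b with P k (0 if there is none).
largestUpTo : {P : ℕ → Set} → ((k : ℕ) → Dec (P k)) → ℕ → ℕ
largestUpTo P? zero = zero
largestUpTo P? (suc b) with P? (suc b)
... | yes _ = suc b
... | no _  = largestUpTo P? b

leastFrom : {P : ℕ → Set} → ((k : ℕ) → Dec (P k)) → ℕ → ℕ → ℕ
leastFrom P? k zero = k
leastFrom P? k (suc fuel) with P? k
... | yes _ = k
... | no _  = leastFrom P? (suc k) fuel

-- z(n): largest integer with 3 z < 2n  (any such z satisfies z < 2n, and for n ≥ 1, z = 0 works)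
z : ℕ → ℕ
z n = largestUpTo (λ k → 3 * k <? 2 * n) (2 * n)

-- m(n): largest integer with m^2 ≤ 2n  (any such m satisfies m ≤ 2n)
m : ℕ → ℕ
m n = largestUpTo (λ k → k * k ≤? 2 * n) (2 * n)

-- r(n): least non-negative integer with n ≤ 2^r  (r = n always works, so n steps suffice)
r : ℕ → ℕ
r n = leastFrom (λ k → n ≤? 2 ^ k) 0 n

x : ℕ → ℤ
x n = + z n - (+ (r n + 1)) *ℤ (+ m n)

-- Since 3 z(n) ≈ 2n while (r(n)+1) m(n) ≈ log₂ n · √(2n), the first term wins for large n:
-- once 9 (r+1)² + 8 ≤ 2n we get 3 (r+1) m ≤ 2n − 4 < 3z, so x(n) > 0, and this holds
-- for all n ≥ 577 because 2^(r+1) ≤ 4n outgrows (r+1)². Similarly 18 (r+1)² ≤ n for n ≥ 4097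
-- gives 3 (r+1) m ≤ n, so x(n) ≥ (n − 3)/3 is unbounded. The finitely many n ≤ 576 are
-- settled by evaluating x.
module Submission where

open import Defs
open import Data.Nat using (ℕ; _≤_; _≥_)
open import Data.Integer using (ℤ; +_; -_) renaming (_<_ to _<ℤ_; _≤_ to _≤ℤ_)
open import Data.Product using (_×_; ∃-syntax; _,_)
open import Data.Sum using (_⊎_)
open import Function.Bundles using (_⇔_)
open import Relation.Binary.PropositionalEquality using (_≡_; _≢_)

open import Data.Nat using (suc; zero; _+_; _*_; _∸_; _^_; _<_; _≤?_; _<?_; z≤n; s≤s; _≤′_; ≤′-refl; ≤′-step)
open import Data.Nat.Properties
open import Data.Nat.Tactic.RingSolver using (solve-∀)
import Data.Integer as ℤ
import Data.Integer.Properties as ℤ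
open import Data.Product using (proj₁; proj₂)
open import Data.Sum using (inj₁; inj₂)
open import Function.Bundles using (mk⇔; Equivalence)
open import Relation.Nullary using (Dec; yes; no; ¬_; ¬?; contradiction)
open import Relation.Nullary.Decidable using (from-yes; from-no; map′; _×-dec_; _⊎-dec_; _→-dec_)
open import Relation.Binary.PropositionalEquality using (refl; sym; trans; cong; subst; module ≡-Reasoning)

module _ {P : ℕ → Set} (P? : (k : ℕ) → Dec (P k)) where

  largestUpTo-sound : P 0 → ∀ b → P (largestUpTo P? b)
  largestUpTo-sound P0 zero = P0
  largestUpTo-sound P0 (suc b) with P? (suc b)
  ... | yes Pb = Pb
  ... | no _   = largestUpTo-sound P0 b

  largestUpTo-maximal : ∀ {b i} → largestUpTo P? b < i → i ≤ b → ¬ P i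
  largestUpTo-maximal {zero} lt i≤0 = contradiction i≤0 (<⇒≱ lt)
  largestUpTo-maximal {suc b} lt i≤b Pi with P? (suc b)
  ... | yes _   = <⇒≱ lt i≤b
  ... | no ¬Pb with m≤n⇒m<n∨m≡n i≤b
  ...   | inj₁ i<1+b = largestUpTo-maximal {b} lt (≤-pred i<1+b) Pi
  ...   | inj₂ refl  = ¬Pb Pi

  leastFrom-sound : ∀ k fuel → P (k + fuel) → P (leastFrom P? k fuel)
  leastFrom-sound k zero Pk = subst P (+-identityʳ k) Pk
  leastFrom-sound k (suc fuel) Pend with P? k
  ... | yes Pk = Pk
  ... | no _   = leastFrom-sound (suc k) fuel (subst P (+-suc k fuel) Pend)

  leastFrom-minimal : ∀ {k fuel i} → k ≤ i → i < leastFrom P? k fuel → ¬ P i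
  leastFrom-minimal {fuel = zero} k≤i i<k = contradiction k≤i (<⇒≱ i<k)
  leastFrom-minimal {k} {suc fuel} k≤i lt Pi with P? k
  ... | yes _   = <⇒≱ lt k≤i
  ... | no ¬Pk with m≤n⇒m<n∨m≡n k≤i
  ...   | inj₁ k<i = leastFrom-minimal {suc k} {fuel} k<i lt Pi
  ...   | inj₂ refl = ¬Pk Pi

m*m≤n*n⇒m≤n : ∀ {a b} → a * a ≤ b * b → a ≤ b
m*m≤n*n⇒m≤n h = ≮⇒≥ λ b<a → <⇒≱ (*-mono-< b<a b<a) h

m+n<o⇒n<o∸m : ∀ {a b c} → a + b < c → b < c ∸ a
m+n<o⇒n<o∸m {a} {b} {c} a+b<c =
  subst (_≤ c ∸ a) (m+n∸m≡n a (suc b)) (∸-monoˡ-≤ a (subst (_≤ c) (sym (+-suc a b)) a+b<c))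

n≤2^n : ∀ n → n ≤ 2 ^ n
n≤2^n zero    = z≤n
n≤2^n (suc n) = +-mono-≤ (m^n>0 2 n) (≤-trans (n≤2^n n) (m≤m+n (2 ^ n) 0))

[1+n]²≤2n² : ∀ {n} → 3 ≤ n → suc n * suc n ≤ 2 * (n * n)
[1+n]²≤2n² {suc (suc (suc k))} (s≤s (s≤s (s≤s _))) =
  subst ((4 + k) * (4 + k) ≤_) (sym (split k)) (m≤m+n _ _)
  where
  split : ∀ k → 2 * ((3 + k) * (3 + k)) ≡ (4 + k) * (4 + k) + (2 + 4 * k + k * k)
  split = solve-∀

c*a²≤2^a⇒c*b²≤2^b : ∀ {c a b} → 3 ≤ a → a ≤ b → c * (a * a) ≤ 2 ^ a → c * (b * b) ≤ 2 ^ b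
c*a²≤2^a⇒c*b²≤2^b {c} {a} 3≤a a≤b base = go (≤⇒≤′ a≤b)
  where
  open ≤-Reasoning
  swap : ∀ c s → c * (2 * s) ≡ 2 * (c * s)
  swap = solve-∀
  go : ∀ {b} → a ≤′ b → c * (b * b) ≤ 2 ^ b
  go ≤′-refl = base
  go {suc b} (≤′-step a≤′b) = begin
    c * (suc b * suc b) ≤⟨ *-monoʳ-≤ c ([1+n]²≤2n² (≤-trans 3≤a (≤′⇒≤ a≤′b))) ⟩
    c * (2 * (b * b))   ≡⟨ swap c (b * b) ⟩
    2 * (c * (b * b))   ≤⟨ *-monoʳ-≤ 2 (go a≤′b) ⟩
    2 * 2 ^ b           ∎

3RM≤t : ∀ {R M s t} → M * M ≤ s → 9 * (R * R) * s ≤ t * t → 3 * (R * M) ≤ t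
3RM≤t {R} {M} {s} {t} M²≤s 9R²s≤t² = m*m≤n*n⇒m≤n (begin
  3 * (R * M) * (3 * (R * M)) ≡⟨ expand R M ⟩
  9 * (R * R) * (M * M)       ≤⟨ *-monoʳ-≤ (9 * (R * R)) M²≤s ⟩
  9 * (R * R) * s             ≤⟨ 9R²s≤t² ⟩
  t * t                       ∎)
  where
  open ≤-Reasoning
  expand : ∀ R M → 3 * (R * M) * (3 * (R * M)) ≡ 9 * (R * R) * (M * M)
  expand = solve-∀

2n≤3z+3 : ∀ n → 2 * n ≤ 3 * z n + 3
2n≤3z+3 n with suc (z n) ≤? 2 * n
... | yes 1+z≤2n = ≮⇒≥ λ 3z+3<2n →
  largestUpTo-maximal (λ k → 3 * k <? 2 * n) ≤-refl 1+z≤2n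
    (subst (_< 2 * n) (trans (+-comm (3 * z n) 3) (sym (*-suc 3 (z n)))) 3z+3<2n)
... | no 1+z≰2n = ≤-trans (≤-pred (≰⇒> 1+z≰2n)) (≤-trans (m≤m+n (z n) _) (m≤m+n _ 3))

m²≤2n : ∀ n → m n * m n ≤ 2 * n
m²≤2n n = largestUpTo-sound (λ k → k * k ≤? 2 * n) z≤n (2 * n)

n≤2^r : ∀ n → n ≤ 2 ^ r n
n≤2^r n = leastFrom-sound (λ k → n ≤? 2 ^ k) 0 n (n≤2^n n)

R : ℕ → ℕ
R n = r n + 1

2^j<n⇒j+1<R : ∀ {n} j → 2 ^ j < n → j + 1 < R n
2^j<n⇒j+1<R {n} j 2^j<n =
  +-monoˡ-≤ 1 (≰⇒> λ r≤j → <⇒≱ 2^j<n (≤-trans (n≤2^r n) (^-monoʳ-≤ 2 r≤j)))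

2^R≤4n : ∀ {n} → 1 ≤ n → 2 ^ R n ≤ 4 * n
2^R≤4n {n} 1≤n with r n in r≡
... | zero  = ≤-trans (from-yes (2 ≤? 4)) (*-monoʳ-≤ 4 1≤n)
... | suc j = begin
  2 ^ (suc j + 1) ≡⟨ cong (2 ^_) (+-comm (suc j) 1) ⟩
  2 * (2 * 2 ^ j) ≡⟨ *-assoc 2 2 (2 ^ j) ⟨
  4 * 2 ^ j       ≤⟨ *-monoʳ-≤ 4 (<⇒≤ 2^j<n) ⟩
  4 * n           ∎
  where
  open ≤-Reasoning
  2^j<n : 2 ^ j < n
  2^j<n = ≰⇒> (leastFrom-minimal (λ k → n ≤? 2 ^ k) {0} {n} z≤n (subst (j <_) (sym r≡) ≤-refl))

9R²+8≤2n : ∀ {n} → 577 ≤ n → 9 * (R n * R n) + 8 ≤ 2 * n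
9R²+8≤2n {n} 577≤n with m≤n⇒m<n∨m≡n (2^j<n⇒j+1<R 9 (≤-trans (from-yes (2 ^ 9 <? 577)) 577≤n))
... | inj₂ 11≡R = subst (λ t → 9 * (t * t) + 8 ≤ 2 * n) 11≡R
  (≤-trans (from-yes (1097 ≤? 1154)) (*-monoʳ-≤ 2 577≤n))
... | inj₁ 12≤R = *-cancelˡ-≤ 2 (begin
  2 * (9 * R² + 8) ≤⟨ *-monoʳ-≤ 2 (+-monoʳ-≤ (9 * R²) 8≤R²) ⟩
  2 * (9 * R² + R²) ≡⟨ cong (2 *_) (tenfold R²) ⟩
  2 * (10 * R²)   ≡⟨ *-assoc 2 10 R² ⟨
  20 * R²         ≤⟨ c*a²≤2^a⇒c*b²≤2^b {20} (from-yes (3 ≤? 12)) 12≤R (from-yes (20 * 144 ≤? 2 ^ 12)) ⟩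
  2 ^ R n         ≤⟨ 2^R≤4n (≤-trans (from-yes (1 ≤? 577)) 577≤n) ⟩
  4 * n           ≡⟨ *-assoc 2 2 n ⟩
  2 * (2 * n)     ∎)
  where
  open ≤-Reasoning
  R² = R n * R n
  8≤R² : 8 ≤ R²
  8≤R² = <⇒≤ (*-mono-≤ 3≤R 3≤R)
    where
    3≤R : 3 ≤ R n
    3≤R = ≤-trans (from-yes (3 ≤? 12)) 12≤R
  tenfold : ∀ s → 9 * s + s ≡ 10 * s
  tenfold = solve-∀

18R²≤n : ∀ {n} → 4097 ≤ n → 18 * (R n * R n) ≤ n
18R²≤n {n} 4097≤n = *-cancelˡ-≤ 4 (begin
  4 * (18 * (R n * R n)) ≡⟨ *-assoc 4 18 (R n * R n) ⟨
  72 * (R n * R n)       ≤⟨ c*a²≤2^a⇒c*b²≤2^b {72} (from-yes (3 ≤? 14)) 14≤R (from-yes (72 * 196 ≤? 2 ^ 14)) ⟩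
  2 ^ R n                ≤⟨ 2^R≤4n (≤-trans (from-yes (1 ≤? 4097)) 4097≤n) ⟩
  4 * n                  ∎)
  where
  open ≤-Reasoning
  14≤R : 14 ≤ R n
  14≤R = 2^j<n⇒j+1<R 12 (≤-trans (from-yes (2 ^ 12 <? 4097)) 4097≤n)

x≡z∸Rm : ∀ {n} → R n * m n ≤ z n → x n ≡ + (z n ∸ R n * m n)
x≡z∸Rm {n} Rm≤z = begin
  + z n ℤ.- + R n ℤ.* + m n ≡⟨ cong (λ t → + z n ℤ.- t) (ℤ.pos-* (R n) (m n)) ⟨
  + z n ℤ.- + (R n * m n)   ≡⟨ ℤ.m-n≡m⊖n (z n) (R n * m n) ⟩
  z n ℤ.⊖ (R n * m n)       ≡⟨ ℤ.⊖-≥ Rm≤z ⟩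
  + (z n ∸ R n * m n)       ∎
  where open ≡-Reasoning

-- 3a + 4 ≤ 2n ≤ 3z + 3 forces 3a < 3z, hence a < z, for a = Rm + k.
k<x : ∀ {n} k → 3 * (R n * m n + k) + 4 ≤ 2 * n → + k <ℤ x n
k<x {n} k bound = subst (+ k <ℤ_) (sym (x≡z∸Rm {n} Rm≤z)) (ℤ.+<+ (m+n<o⇒n<o∸m Rm+k<z))
  where
  open ≤-Reasoning
  Rm+k<z : R n * m n + k < z n
  Rm+k<z = *-cancelˡ-< 3 _ _ (+-cancelʳ-≤ 3 _ _ (begin
    suc (3 * (R n * m n + k)) + 3 ≡⟨ +-suc (3 * (R n * m n + k)) 3 ⟨
    3 * (R n * m n + k) + 4       ≤⟨ bound ⟩
    2 * n                         ≤⟨ 2n≤3z+3 n ⟩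
    3 * z n + 3                   ∎))
  Rm≤z : R n * m n ≤ z n
  Rm≤z = ≤-trans (m≤m+n _ k) (<⇒≤ Rm+k<z)

0<x : ∀ {n} → 577 ≤ n → + 0 <ℤ x n
0<x {n} 577≤n = k<x {n} 0 (begin
  3 * (R n * m n + 0) + 4 ≡⟨ cong (λ t → 3 * t + 4) (+-identityʳ (R n * m n)) ⟩
  3 * (R n * m n) + 4     ≤⟨ +-monoˡ-≤ 4 (3RM≤t {R n} {m n} (subst (m n * m n ≤_) 2n≡p+4 (m²≤2n n)) 9R²[p+4]≤p²) ⟩
  p + 4                   ≡⟨ 2n≡p+4 ⟨
  2 * n                   ∎)
  where
  open ≤-Reasoning
  p = 2 * n ∸ 4
  2n≡p+4 : 2 * n ≡ p + 4
  2n≡p+4 = sym (m∸n+n≡m (≤-trans (from-yes (4 ≤? 1154)) (*-monoʳ-≤ 2 577≤n)))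
  K = 9 * (R n * R n)
  K+4≤p : K + 4 ≤ p
  K+4≤p = +-cancelʳ-≤ 4 _ _ (begin
    K + 4 + 4 ≡⟨ +-assoc K 4 4 ⟩
    K + 8     ≤⟨ 9R²+8≤2n 577≤n ⟩
    2 * n     ≡⟨ 2n≡p+4 ⟩
    p + 4     ∎)
  K≤p : K ≤ p
  K≤p = ≤-trans (m≤m+n K 4) K+4≤p
  9R²[p+4]≤p² : K * (p + 4) ≤ p * p
  9R²[p+4]≤p² = begin
    K * (p + 4)    ≡⟨ *-distribˡ-+ K p 4 ⟩
    K * p + K * 4  ≤⟨ +-monoʳ-≤ (K * p) (*-monoˡ-≤ 4 K≤p) ⟩
    K * p + p * 4  ≡⟨ cong (_+_ (K * p)) (*-comm p 4) ⟩
    K * p + 4 * p  ≡⟨ *-distribʳ-+ p K 4 ⟨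
    (K + 4) * p    ≤⟨ *-monoˡ-≤ p K+4≤p ⟩
    p * p          ∎

i≤+∣i∣ : ∀ i → i ≤ℤ + ℤ.∣ i ∣
i≤+∣i∣ (+ n)      = ℤ.≤-refl
i≤+∣i∣ ℤ.-[1+ n ] = ℤ.-≤+

x-unbounded : (B : ℤ) → ∃[ n ] (1 ≤ n × B <ℤ x n)
x-unbounded B = n , ≤-trans (from-yes (1 ≤? 4100)) 4100≤n , ℤ.≤-<-trans B≤b (k<x {n} b bound)
  where
  open ≤-Reasoning
  b = ℤ.∣ B ∣
  n = 3 * b + 4100
  4100≤n : 4100 ≤ n
  4100≤n = m≤n+m 4100 (3 * b)
  B≤b : B ≤ℤ + b
  B≤b = i≤+∣i∣ B
  3Rm≤n : 3 * (R n * m n) ≤ n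
  3Rm≤n = 3RM≤t {R n} {m n} (m²≤2n n) (begin
    9 * (R n * R n) * (2 * n) ≡⟨ regroup (R n * R n) n ⟩
    18 * (R n * R n) * n      ≤⟨ *-monoˡ-≤ n (18R²≤n (≤-trans (from-yes (4097 ≤? 4100)) 4100≤n)) ⟩
    n * n                     ∎)
    where
    regroup : ∀ s n → 9 * s * (2 * n) ≡ 18 * s * n
    regroup = solve-∀
  bound : 3 * (R n * m n + b) + 4 ≤ 2 * n
  bound = begin
    3 * (R n * m n + b) + 4 ≡⟨ distrib (R n * m n) b ⟩
    3 * (R n * m n) + (3 * b + 4) ≤⟨ +-mono-≤ 3Rm≤n (+-monoʳ-≤ (3 * b) (from-yes (4 ≤? 4100))) ⟩
    n + n                   ≡⟨ cong (_+_ n) (+-identityʳ n) ⟨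
    2 * n                   ∎
    where
    distrib : ∀ a b → 3 * (a + b) + 4 ≡ 3 * a + (3 * b + 4)
    distrib = solve-∀

Zeros : ℕ → Set
Zeros n = n ≡ 436 ⊎ n ≡ 451 ⊎ n ≡ 529 ⊎ n ≡ 545 ⊎ n ≡ 546

Negatives : ℕ → Set
Negatives n = n ≤ 435 ⊎ n ≡ 450 ⊎ (513 ≤ n × n ≤ 528)

Positives : ℕ → Set
Positives n = (437 ≤ n × n ≤ 512 × n ≢ 450 × n ≢ 451) ⊎ (n ≥ 530 × n ≢ 545 × n ≢ 546)

Classified : ℕ → ℤ → Set
Classified n v = (v ≡ + 0 ⇔ Zeros n) × (v <ℤ + 0 ⇔ Negatives n) × (+ 0 <ℤ v ⇔ Positives n)
               × (n ≢ 129 → - (+ 58) ≤ℤ v)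

_⇔?_ : {A B : Set} → Dec A → Dec B → Dec (A ⇔ B)
A? ⇔? B? = map′ (λ (f , g) → mk⇔ f g) (λ A⇔B → Equivalence.to A⇔B , Equivalence.from A⇔B)
  ((A? →-dec B?) ×-dec (B? →-dec A?))

classified? : ∀ n v → Dec (Classified n v)
classified? n v = ((v ℤ.≟ + 0) ⇔? zeros?) ×-dec ((v ℤ.<? + 0) ⇔? negatives?)
  ×-dec ((+ 0 ℤ.<? v) ⇔? positives?) ×-dec (¬? (n ≟ 129) →-dec (- (+ 58) ℤ.≤? v))
  where
  zeros?     = (n ≟ 436) ⊎-dec (n ≟ 451) ⊎-dec (n ≟ 529) ⊎-dec (n ≟ 545) ⊎-dec (n ≟ 546)
  negatives? = (n ≤? 435) ⊎-dec (n ≟ 450) ⊎-dec ((513 ≤? n) ×-dec (n ≤? 528))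
  positives? = ((437 ≤? n) ×-dec (n ≤? 512) ×-dec ¬? (n ≟ 450) ×-dec ¬? (n ≟ 451))
          ⊎-dec ((530 ≤? n) ×-dec ¬? (n ≟ 545) ×-dec ¬? (n ≟ 546))

classified-≤576 : ∀ {k} → k < 576 → Classified (suc k) (x (suc k))
classified-≤576 = from-yes (allUpTo? (λ k → classified? (suc k) (x (suc k))) 576)

¬Zeros : ∀ {n} → 547 ≤ n → ¬ Zeros n
¬Zeros 547≤n (inj₁ refl)                         = contradiction 547≤n (from-no (547 ≤? 436))
¬Zeros 547≤n (inj₂ (inj₁ refl))                  = contradiction 547≤n (from-no (547 ≤? 451))
¬Zeros 547≤n (inj₂ (inj₂ (inj₁ refl)))           = contradiction 547≤n (from-no (547 ≤? 529))
¬Zeros 547≤n (inj₂ (inj₂ (inj₂ (inj₁ refl))))    = contradiction 547≤n (from-no (547 ≤? 545))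
¬Zeros 547≤n (inj₂ (inj₂ (inj₂ (inj₂ refl))))    = contradiction 547≤n (from-no (547 ≤? 546))

¬Negatives : ∀ {n} → 547 ≤ n → ¬ Negatives n
¬Negatives 547≤n (inj₁ n≤435)             = contradiction (≤-trans 547≤n n≤435) (from-no (547 ≤? 435))
¬Negatives 547≤n (inj₂ (inj₁ refl))       = contradiction 547≤n (from-no (547 ≤? 450))
¬Negatives 547≤n (inj₂ (inj₂ (_ , n≤528))) = contradiction (≤-trans 547≤n n≤528) (from-no (547 ≤? 528))

Positives-≥547 : ∀ {n} → 547 ≤ n → Positives n
Positives-≥547 547≤n = inj₂ (≤-trans (from-yes (530 ≤? 547)) 547≤n
                           , (λ where refl → contradiction 547≤n (from-no (547 ≤? 545)))
                           , (λ where refl → contradiction 547≤n (from-no (547 ≤? 546))))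

classified-positive : ∀ {n v} → 547 ≤ n → + 0 <ℤ v → Classified n v
classified-positive 547≤n 0<v =
    mk⇔ (λ v≡0 → contradiction (sym v≡0) (ℤ.<⇒≢ 0<v)) (λ zeros → contradiction zeros (¬Zeros 547≤n))
  , mk⇔ (λ v<0 → contradiction v<0 (ℤ.<-asym 0<v)) (λ neg → contradiction neg (¬Negatives 547≤n))
  , mk⇔ (λ _ → Positives-≥547 547≤n) (λ _ → 0<v)
  , λ _ → ℤ.≤-trans (from-yes (- (+ 58) ℤ.≤? + 0)) (ℤ.<⇒≤ 0<v)

classified : ∀ {n} → 1 ≤ n → Classified n (x n)
classified {suc k} _ with suc k ≤? 576
... | yes k<576 = classified-≤576 k<576
... | no  k≮576 = classified-positive (≤-trans (from-yes (547 ≤? 577)) 577≤n) (0<x 577≤n)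
  where
  577≤n : 577 ≤ suc k
  577≤n = ≰⇒> k≮576

theorem1 : ((n : ℕ) → 1 ≤ n →
    (x n ≡ + 0 ⇔ (n ≡ 436 ⊎ n ≡ 451 ⊎ n ≡ 529 ⊎ n ≡ 545 ⊎ n ≡ 546)))
    × ((n : ℕ) → 1 ≤ n →
    (x n <ℤ + 0 ⇔ (n ≤ 435 ⊎ n ≡ 450 ⊎ (513 ≤ n × n ≤ 528))))
    × ((n : ℕ) → 1 ≤ n →
    (+ 0 <ℤ x n ⇔ ((437 ≤ n × n ≤ 512 × n ≢ 450 × n ≢ 451)
    ⊎ (n ≥ 530 × n ≢ 545 × n ≢ 546))))
    × ((n : ℕ) → n ≥ 547 → + 0 <ℤ x n)
    × ((B : ℤ) → ∃[ n ] (1 ≤ n × B <ℤ x n))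
    × (x 129 ≡ - (+ 59))
    × ((n : ℕ) → 1 ≤ n → n ≢ 129 → - (+ 58) ≤ℤ x n)
theorem1 =
    (λ _ 1≤n → proj₁ (classified 1≤n))
  , (λ _ 1≤n → proj₁ (proj₂ (classified 1≤n)))
  , (λ _ 1≤n → proj₁ (proj₂ (proj₂ (classified 1≤n))))
  , (λ _ 547≤n → Equivalence.from (proj₁ (proj₂ (proj₂ (classified (≤-trans (from-yes (1 ≤? 547)) 547≤n)))))
                   (Positives-≥547 547≤n))
  , x-unbounded
  , refl
  , (λ _ 1≤n → proj₂ (proj₂ (proj₂ (classified 1≤n))))
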